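{- For all closed session types $T,S$: $T\le_a S$ is not derivable if and only if $T\ntriangleleft_a S$ is derivable.
   Context: Session types: $T,S ::= \&_{i\in I}?l_i(S_i).T_i \mid \bigoplus_{i\in I}!l_i\langle S_i\rangle.T_i \mid \mathbf t \mid \mu\mathbf t.T \mid \mathsf{end}$, with pairwise distinct labels in each branching/selection, closed exchanged types and contractive recursion; types are equi-recursive (identified when they have the same regular tree). Asynchronous contexts: $\mathcal A ::= [\,]^n \mid \&_{i\in I}?l_i(S_i).\mathcal A_i$, holes indexed by distinct indices; $\mathcal A[T_n]^{n\in N}$ fills hole $[\,]^n$ with $T_n$ ($N$ the set of hole indices). $\&\in\mathcal A$ means $\mathcal A$ is not a single hole. Predicates on (possibly open) types, inductively: $\&\in\&_{i}?l_i(S_i).T_i$; $\&\in\bigoplus_{i\in I}!l_i\langle S_i\rangle.T_i$ if $\&\in T_i$ for all $i$; $\&\in\mu\mathbf t.T$ if $\&\in T$. $\&\notin\mathsf{end}$; $\&\notin\mathbf t$; $\&\notin\bigoplus_{i\in I}!l_i\langle S_i\rangle.T_i$ if $\&\notin T_i$ for some $i$; $\&\notin\mu\mathbf t.T$ if $\&\notin T$. Dually, $\oplus\in\bigoplus_i!l_i\langle S_i\rangle.T_i$; $\oplus\in\&_{i\in I}?l_i(S_i).T_i$ if $\oplus\in T_i$ for all $i$; $\oplus\in\mu\mathbf t.T$ if $\oplus\in T$; $\oplus\notin\mathsf{end}$; $\oplus\notin\mathbf t$; $\oplus\notin\&_{i\in I}?l_i(S_i).T_i$ if $\oplus\notin T_i$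 for some $i$; $\oplus\notin\mu\mathbf t.T$ if $\oplus\notin T$. Asynchronous subtyping $\le_a$ is the largest (coinductively defined) relation on closed types such that $T\le_a S$ implies one of: $T=S=\mathsf{end}$; $T=\&_{i\in I\cup J}?l_i(S_i).T_i$, $S=\&_{i\in I}?l_i(S'_i).T'_i$ with $S_i\le_a S'_i$, $T_i\le_a T'_i$ ($i\in I$); $T=\bigoplus_{i\in I}!l_i\langle S_i\rangle.T_i$, $S=\bigoplus_{i\in I\cup J}!l_i\langle S'_i\rangle.T'_i$ with $S'_i\le_a S_i$, $T_i\le_a T'_i$ ($i\in I$); or $T=\bigoplus_{i\in I}!l_i\langle S_i\rangle.T_i$, $S=\mathcal A[\bigoplus_{i\in I\cup J_n}!l_i\langle S^n_i\rangle.T^n_i]^{n\in N}$ with $\&\in\mathcal A$ and, for all $i\in I,n\in N$, $S^n_i\le_a S_i$, $T_i\le_a\mathcal A[T^n_i]^{n\in N}$, $\&\in T_i$. The relation $\ntriangleleft_a$ is defined inductively by the rules: $\mathsf{end}\ntriangleleft T$ if $T\ne\mathsf{end}$; $T\ntriangleleft\mathsf{end}$ if $T\ne\mathsf{end}$; $\&_{i\in I}?l_i(S_i).T_i\ntriangleleft\bigoplus_{j\in J}!l'_j\langle S'_j\rangle.T'_j$; $\&_{i\in I}?l_i(S_i).T_i\ntriangleleft\&_{j\in J}?l'_j(S'_j).T'_j$ if (a) $\exists j\in J\,\forall i\in I: l_i\ne l'_j$, or (b) $\exists i,j$ with $l_i=l'_j$ and $S_i\ntriangleleft S'_j$, or (c)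 $\exists i,j$ with $l_i=l'_j$ and $T_i\ntriangleleft T'_j$; $\bigoplus_{i\in I}!l_i\langle S_i\rangle.T_i\ntriangleleft\bigoplus_{j\in J}!l'_j\langle S'_j\rangle.T'_j$ if (a) $\exists i\in I\,\forall j\in J: l_i\ne l'_j$, or (b) $\exists i,j$ with $l_i=l'_j$ and $S'_j\ntriangleleft S_i$, or (c) $\exists i,j$ with $l_i=l'_j$ and $T_i\ntriangleleft T'_j$; and, for $T=\bigoplus_{i\in I}!l_i\langle S_i\rangle.T_i$ and $S=\mathcal A[\bigoplus_{j\in J_n}!l^n_j\langle S^n_j\rangle.T^n_j]^{n\in N}$: $T\ntriangleleft S$ if $\exists i_0\in I\,\exists n_0\in N\,\forall j\in J_{n_0}: l^{n_0}_j\ne l_{i_0}$; $T\ntriangleleft S$ if $\exists i_0\in I,n_0\in N,j_0\in J_{n_0}$ with $l^{n_0}_{j_0}=l_{i_0}$ and $S^{n_0}_{j_0}\ntriangleleft S_{i_0}$; $T\ntriangleleft S$ if for all $i\in I,n\in N$ there is $j_{i,n}\in J_n$ with $l^n_{j_{i,n}}=l_i$, and $\exists i_0\in I$ with $T_{i_0}\ntriangleleft\mathcal A[T^n_{j_{i_0,n}}]^{n\in N}$; finally $T\ntriangleleft\&_{i\in I}?l_i(S_i).T_i$ if $\&\notin T$, and $\bigoplus_{i\in I}!l_i\langle S_i\rangle.T_i\ntriangleleft T$ if $\oplus\notin T$. (The rule "selection $\ntriangleleft$ branching" is not included.) -}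

module Defs where

open import Level using (0ℓ)
open import Data.Nat using (ℕ; zero; suc)
open import Data.Fin using (Fin; zero; suc)
open import Data.List using (List; []; _∷_; map)
open import Data.List.Relation.Unary.All using (All)
open import Data.List.Relation.Unary.Any using (Any)
open import Data.List.Membership.Propositional using (_∈_)
import Data.List.Relation.Unary.Unique.Propositional as UniqueP
open import Data.Product using (Σ; Σ-syntax; _×_; _,_; proj₁; proj₂)
open import Data.Sum using (_⊎_)
open import Relation.Nullary using (¬_)
open import Relation.Binary.PropositionalEquality using (_≡_; _≢_)

-- A branching &_{i∈I} ?l_i(S_i).T_i / selection ⊕_{i∈I} !l_i⟨S_i⟩.T_i
-- is given by the list of its triples (l_i , S_i , T_i).  The order of the list is irrelevant for all
-- relations below (they only use membership).

Label : Set
Label = ℕ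

data Ty : ℕ → Set where
  end : ∀ {n} → Ty n
  var : ∀ {n} → Fin n → Ty n
  μ   : ∀ {n} → Ty (suc n) → Ty n
  bra : ∀ {n} → List (Label × Ty 0 × Ty n) → Ty n
  sel : ∀ {n} → List (Label × Ty 0 × Ty n) → Ty n

lab : ∀ {n} → Label × Ty 0 × Ty n → Label
lab b = proj₁ b

pay : ∀ {n} → Label × Ty 0 × Ty n → Ty 0
pay b = proj₁ (proj₂ b)

cont : ∀ {n} → Label × Ty 0 × Ty n → Ty n
cont b = proj₂ (proj₂ b)

-- Renaming and substitution (only on the continuation parts; exchanged
-- types are closed).

ext : ∀ {n m} → (Fin n → Fin m) → Fin (suc n) → Fin (suc m)
ext ρ zero    = zero
ext ρ (suc x) = suc (ρ x)

ren  : ∀ {n m} → (Fin n → Fin m) → Ty n → Ty m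
renL : ∀ {n m} → (Fin n → Fin m) → List (Label × Ty 0 × Ty n) → List (Label × Ty 0 × Ty m)
ren ρ end      = end
ren ρ (var x)  = var (ρ x)
ren ρ (μ T)    = μ (ren (ext ρ) T)
ren ρ (bra bs) = bra (renL ρ bs)
ren ρ (sel bs) = sel (renL ρ bs)
renL ρ []                  = []
renL ρ ((l , P , T) ∷ bs) = (l , P , ren ρ T) ∷ renL ρ bs

exts : ∀ {n m} → (Fin n → Ty m) → Fin (suc n) → Ty (suc m)
exts σ zero    = var zero
exts σ (suc x) = ren suc (σ x)

sub  : ∀ {n m} → (Fin n → Ty m) → Ty n → Ty m
subL : ∀ {n m} → (Fin n → Ty m) → List (Label × Ty 0 × Ty n) → List (Label × Ty 0 × Ty m)
sub σ end      = end
sub σ (var x)  = σ x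
sub σ (μ T)    = μ (sub (exts σ) T)
sub σ (bra bs) = bra (subL σ bs)
sub σ (sel bs) = sel (subL σ bs)
subL σ []                  = []
subL σ ((l , P , T) ∷ bs) = (l , P , sub σ T) ∷ subL σ bs

unfoldμ : Ty 1 → Ty 0
unfoldμ T = sub σ T
  where
  σ : Fin 1 → Ty 0
  σ zero = μ T

-- Well-formedness of (closed) session types: pairwise distinct labels in
-- every branching/selection and contractive recursion (no subterm
-- μt1...μtk.t1).

data HeadVar : ∀ {n} → Ty n → Fin n → Set where
  hv-var : ∀ {n} {x : Fin n} → HeadVar (var x) x
  hv-mu  : ∀ {n} {T : Ty (suc n)} {x : Fin n} → HeadVar T (suc x) → HeadVar (μ T) x

Distinct : ∀ {n} → List (Label × Ty 0 × Ty n) → Set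
Distinct bs = UniqueP.Unique (map lab bs)

data WF : ∀ {n} → Ty n → Set where
  wf-end : ∀ {n} → WF {n} end
  wf-var : ∀ {n} {x : Fin n} → WF (var x)
  wf-mu  : ∀ {n} {T : Ty (suc n)} → ¬ HeadVar T zero → WF T → WF (μ T)
  wf-bra : ∀ {n} {bs : List (Label × Ty 0 × Ty n)} → Distinct bs →
           All (λ b → WF (pay b) × WF (cont b)) bs → WF (bra bs)
  wf-sel : ∀ {n} {bs : List (Label × Ty 0 × Ty n)} → Distinct bs →
           All (λ b → WF (pay b) × WF (cont b)) bs → WF (sel bs)

ClosedTy : Set
ClosedTy = Σ (Ty 0) WF

-- Equi-recursion: a closed type T "unfolds to" its top-level constructor
-- (end / branching / selection) by finitely many μ-unfoldings; T and its
-- unfolding have the same regular tree.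

Br : Set
Br = Label × Ty 0 × Ty 0

data Unf : Ty 0 → Ty 0 → Set where
  u-end : Unf end end
  u-bra : ∀ {bs} → Unf (bra bs) (bra bs)
  u-sel : ∀ {bs} → Unf (sel bs) (sel bs)
  u-mu  : ∀ {T H} → Unf (unfoldμ T) H → Unf (μ T) H

data BraIn : ∀ {n} → Ty n → Set where
  bi-bra : ∀ {n} {bs : List (Label × Ty 0 × Ty n)} → BraIn (bra bs)
  bi-sel : ∀ {n} {bs : List (Label × Ty 0 × Ty n)} → All (λ b → BraIn (cont b)) bs → BraIn (sel bs)
  bi-mu  : ∀ {n} {T : Ty (suc n)} → BraIn T → BraIn (μ T)

data BraOut : ∀ {n} → Ty n → Set where
  bo-end : ∀ {n} → BraOut {n} end
  bo-var : ∀ {n} {x : Fin n} → BraOut (var x)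
  bo-sel : ∀ {n} {bs : List (Label × Ty 0 × Ty n)} → Any (λ b → BraOut (cont b)) bs → BraOut (sel bs)
  bo-mu  : ∀ {n} {T : Ty (suc n)} → BraOut T → BraOut (μ T)

data SelIn : ∀ {n} → Ty n → Set where
  si-sel : ∀ {n} {bs : List (Label × Ty 0 × Ty n)} → SelIn (sel bs)
  si-bra : ∀ {n} {bs : List (Label × Ty 0 × Ty n)} → All (λ b → SelIn (cont b)) bs → SelIn (bra bs)
  si-mu  : ∀ {n} {T : Ty (suc n)} → SelIn T → SelIn (μ T)

data SelOut : ∀ {n} → Ty n → Set where
  so-end : ∀ {n} → SelOut {n} end
  so-var : ∀ {n} {x : Fin n} → SelOut (var x)
  so-bra : ∀ {n} {bs : List (Label × Ty 0 × Ty n)} → Any (λ b → SelOut (cont b)) bs → SelOut (bra bs)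
  so-mu  : ∀ {n} {T : Ty (suc n)} → SelOut T → SelOut (μ T)

-- Asynchronous contexts, presented as a decomposition S = 𝒜[S_n]^{n∈N}
-- of a given closed type S: a finite prefix of branching nodes of (the
-- tree of) S.  A node records that S unfolds to a branching
-- &_{i} ?l_i(S_i).S'_i and carries a sub-context for each continuation
-- S'_i; a hole [ ]^n sits at some subterm S_n of S.  Holes are indexed by
-- their positions (Hole c), which are pairwise distinct.

data Ctx  : Ty 0 → Set
data CtxL : List Br → Set

data Ctx where
  hole : ∀ {S} → Ctx S
  node : ∀ {S bs} → Unf S (bra bs) → CtxL bs → Ctx S

data CtxL where
  []  : CtxL []
  _∷_ : ∀ {l P T bs} → Ctx T → CtxL bs → CtxL ((l , P , T) ∷ bs)

data IsNode : ∀ {S} → Ctx S → Set where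
  is-node : ∀ {S bs} {u : Unf S (bra bs)} {cs : CtxL bs} → IsNode (node u cs)

data Hole  : ∀ {S} → Ctx S → Set
data HoleL : ∀ {bs} → CtxL bs → Set

data Hole where
  here  : ∀ {S} → Hole (hole {S})
  there : ∀ {S bs} {u : Unf S (bra bs)} {cs : CtxL bs} → HoleL cs → Hole (node u cs)

data HoleL where
  hd : ∀ {l P T bs} {c : Ctx T} {cs : CtxL bs} → Hole c → HoleL {(l , P , T) ∷ bs} (c ∷ cs)
  tl : ∀ {l P T bs} {c : Ctx T} {cs : CtxL bs} → HoleL cs → HoleL {(l , P , T) ∷ bs} (c ∷ cs)

holeTy  : ∀ {S} {c : Ctx S} → Hole c → Ty 0
holeTyL : ∀ {bs} {cs : CtxL bs} → HoleL cs → Ty 0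
holeTy {S} here = S
holeTy (there h) = holeTyL h
holeTyL (hd h) = holeTy h
holeTyL (tl h) = holeTyL h

fill  : ∀ {S} (c : Ctx S) → (Hole c → Ty 0) → Ty 0
fillL : ∀ {bs} (cs : CtxL bs) → (HoleL cs → Ty 0) → List Br
fill hole f = f here
fill (node u cs) f = bra (fillL cs (λ h → f (there h)))
fillL [] f = []
fillL (_∷_ {l} {P} c cs) f = (l , P , fill c (λ h → f (hd h))) ∷ fillL cs (λ h → f (tl h))

Match : Label → List Br → Set
Match l ss = Σ[ b ∈ Br ] (b ∈ ss × lab b ≡ l)

-- Asynchronous subtyping ≤a: the largest relation on closed types that
-- is a post-fixpoint of the following clauses.

Rel : Set₁
Rel = Ty 0 → Ty 0 → Set

SubF : Rel → Rel
SubF R T S =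
  (Unf T end × Unf S end)
  ⊎
  (Σ[ ts ∈ List Br ] Σ[ ss ∈ List Br ] (Unf T (bra ts) × Unf S (bra ss) ×
     (∀ {b'} → b' ∈ ss → Σ[ b ∈ Br ] (b ∈ ts × lab b ≡ lab b' ×
        R (pay b) (pay b') × R (cont b) (cont b')))))
  ⊎
  (Σ[ ts ∈ List Br ] Σ[ ss ∈ List Br ] (Unf T (sel ts) × Unf S (sel ss) ×
     (∀ {b} → b ∈ ts → Σ[ b' ∈ Br ] (b' ∈ ss × lab b' ≡ lab b ×
        R (pay b') (pay b) × R (cont b) (cont b')))))
  ⊎
  (Σ[ ts ∈ List Br ] (Unf T (sel ts) ×
     Σ[ c ∈ Ctx S ] (IsNode c ×
     Σ[ sels ∈ (Hole c → List Br) ] ((∀ h → Unf (holeTy h) (sel (sels h))) ×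
     (∀ {b} → b ∈ ts →
        Σ[ g ∈ ((h : Hole c) → Match (lab b) (sels h)) ]
          ((∀ h → R (pay (proj₁ (g h))) (pay b)) ×
           R (cont b) (fill c (λ h → cont (proj₁ (g h)))) ×
           BraIn (cont b)))))))

_≤a_ : Ty 0 → Ty 0 → Set₁
T ≤a S = Σ[ R ∈ Rel ] (R T S ×
           (∀ {T' S'} → R T' S' → WF T' × WF S' × SubF R T' S'))

data _⋪a_ : Ty 0 → Ty 0 → Set where
  n-endL : ∀ {T S} → Unf T end → ¬ Unf S end → T ⋪a S
  n-endR : ∀ {T S} → ¬ Unf T end → Unf S end → T ⋪a S
  n-bra-sel : ∀ {T S ts ss} → Unf T (bra ts) → Unf S (sel ss) → T ⋪a S
  n-bra-a : ∀ {T S ts ss b'} → Unf T (bra ts) → Unf S (bra ss) →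
            b' ∈ ss → (∀ {b} → b ∈ ts → lab b ≢ lab b') → T ⋪a S
  n-bra-b : ∀ {T S ts ss b b'} → Unf T (bra ts) → Unf S (bra ss) →
            b ∈ ts → b' ∈ ss → lab b ≡ lab b' → pay b ⋪a pay b' → T ⋪a S
  n-bra-c : ∀ {T S ts ss b b'} → Unf T (bra ts) → Unf S (bra ss) →
            b ∈ ts → b' ∈ ss → lab b ≡ lab b' → cont b ⋪a cont b' → T ⋪a S
  n-sel-a : ∀ {T S ts ss b} → Unf T (sel ts) → Unf S (sel ss) →
            b ∈ ts → (∀ {b'} → b' ∈ ss → lab b ≢ lab b') → T ⋪a S
  n-sel-b : ∀ {T S ts ss b b'} → Unf T (sel ts) → Unf S (sel ss) →
            b ∈ ts → b' ∈ ss → lab b ≡ lab b' → pay b' ⋪a pay b → T ⋪a S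
  n-sel-c : ∀ {T S ts ss b b'} → Unf T (sel ts) → Unf S (sel ss) →
            b ∈ ts → b' ∈ ss → lab b ≡ lab b' → cont b ⋪a cont b' → T ⋪a S
  n-ctx-a : ∀ {T S ts b} → Unf T (sel ts) →
            (c : Ctx S) (sels : Hole c → List Br) → (∀ h → Unf (holeTy h) (sel (sels h))) →
            b ∈ ts → (h₀ : Hole c) → (∀ {b'} → b' ∈ sels h₀ → lab b' ≢ lab b) → T ⋪a S
  n-ctx-b : ∀ {T S ts b b'} → Unf T (sel ts) →
            (c : Ctx S) (sels : Hole c → List Br) → (∀ h → Unf (holeTy h) (sel (sels h))) →
            b ∈ ts → (h₀ : Hole c) → b' ∈ sels h₀ → lab b' ≡ lab b → pay b' ⋪a pay b → T ⋪a S
  n-ctx-c : ∀ {T S ts b} → Unf T (sel ts) →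
            (c : Ctx S) (sels : Hole c → List Br) → (∀ h → Unf (holeTy h) (sel (sels h))) →
            (M : ∀ {b₁} → b₁ ∈ ts → (h : Hole c) → Match (lab b₁) (sels h)) →
            (b∈ : b ∈ ts) → cont b ⋪a fill c (λ h → cont (proj₁ (M b∈ h))) → T ⋪a S
  n-notBra : ∀ {T S ss} → Unf S (bra ss) → BraOut T → T ⋪a S
  n-notSel : ∀ {T S ts} → Unf T (sel ts) → SelOut S → T ⋪a S

module Submission where

-- By induction on the derivation of
-- T ⋪a S we show that no relation R satisfying the clauses of ≤a (an
-- "asynchronous simulation") can relate T and S.  Each rule of ⋪a contradicts
-- one inversion principle for a single step SubF R T S.  The subtle rules are
-- those about asynchronous contexts: the rule chooses one decomposition of S
-- into a context with selection holes, R another; we show that such a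
-- decomposition is unique, so the two choices can be aligned.  The rules for
-- plain selections are the special case of the one-hole context.
--
-- The relation "well-formed and not
-- refuted" is itself an asynchronous simulation: each way a single step could
-- fail is excluded by some rule of ⋪a.  This uses that label matching is
-- decidable, that every well-formed closed type unfolds to a head
-- constructor, and that a type S for which ⊕ ∉ S fails decomposes into a
-- context whose holes are selections.  Excluded middle is used once, at the very end, to
-- turn ¬ ¬ (T ⋪a S) into a derivation.

open import Defs
open import Level using (0ℓ)
open import Axiom.ExcludedMiddle using (ExcludedMiddle)
open import Relation.Nullary using (¬_; Dec; yes; no)
open import Relation.Nullary.Decidable using (map′; decidable-stable)
open import Function.Bundles using (_⇔_; mk⇔)
open import Data.Nat using (ℕ; zero; suc; _⊔_; _≤_; s≤s; _≟_)
import Data.Nat.Properties as ℕP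
import Data.Fin.Properties as FinP
open import Data.Fin using (Fin; zero; suc)
open import Data.List using (List; []; _∷_; map)
open import Data.List.Relation.Unary.All using (All; []; _∷_)
import Data.List.Relation.Unary.All as All
import Data.List.Relation.Unary.All.Properties as AllP
open import Data.List.Relation.Unary.Any using (Any; here; there; any?)
open import Data.List.Membership.Propositional using (_∈_; find; lose)
open import Data.List.Relation.Unary.AllPairs using ([]; _∷_)
open import Data.List.Relation.Unary.Unique.Propositional using (Unique)
open import Data.Product using (Σ-syntax; _×_; _,_; proj₁; proj₂)
open import Data.Sum using (inj₁; inj₂)
open import Data.Empty using (⊥; ⊥-elim)
open import Relation.Binary.PropositionalEquality

unf-det : ∀ {T H H'} → Unf T H → Unf T H' → H ≡ H'
unf-det u-end    u-end     = refl
unf-det u-bra    u-bra     = refl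
unf-det u-sel    u-sel     = refl
unf-det (u-mu u) (u-mu u') = unf-det u u'

unf-irrelevant : ∀ {T H} (u u' : Unf T H) → u ≡ u'
unf-irrelevant u-end    u-end     = refl
unf-irrelevant u-bra    u-bra     = refl
unf-irrelevant u-sel    u-sel     = refl
unf-irrelevant (u-mu u) (u-mu u') = cong u-mu (unf-irrelevant u u')

bra-unf-inj : ∀ {T xs ys} → Unf T (bra xs) → Unf T (bra ys) → xs ≡ ys
bra-unf-inj u u' with unf-det u u'
... | refl = refl

sel-unf-inj : ∀ {T xs ys} → Unf T (sel xs) → Unf T (sel ys) → xs ≡ ys
sel-unf-inj u u' with unf-det u u'
... | refl = refl

end≢bra : ∀ {T xs} → Unf T end → ¬ Unf T (bra xs)
end≢bra u u' with unf-det u u'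
... | ()

end≢sel : ∀ {T xs} → Unf T end → ¬ Unf T (sel xs)
end≢sel u u' with unf-det u u'
... | ()

bra≢sel : ∀ {T xs ys} → Unf T (bra xs) → ¬ Unf T (sel ys)
bra≢sel u u' with unf-det u u'
... | ()

AllWF : ∀ {n} → List (Label × Ty 0 × Ty n) → Set
AllWF bs = All (λ b → WF (pay b) × WF (cont b)) bs

-- A head variable of a renamed / substituted type comes from a head
-- variable of the original type; this keeps recursion contractive.
hv-ren : ∀ {n m} {ρ : Fin n → Fin m} (T : Ty n) {y} → HeadVar (ren ρ T) y →
         Σ[ x ∈ Fin n ] (HeadVar T x × ρ x ≡ y)
hv-ren (var x) hv-var = x , hv-var , refl
hv-ren (μ T) (hv-mu p) with hv-ren T p
... | suc x , q , e = x , hv-mu q , FinP.suc-injective e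

hv-sub : ∀ {n m} {σ : Fin n → Ty m} (T : Ty n) {y} → HeadVar (sub σ T) y →
         Σ[ x ∈ Fin n ] (HeadVar T x × HeadVar (σ x) y)
hv-sub (var x) p = x , hv-var , p
hv-sub {σ = σ} (μ T) (hv-mu p) with hv-sub T p
... | suc x , q , r with hv-ren (σ x) r
...   | _ , r' , refl = x , hv-mu q , r'

labels-renL : ∀ {n m} (ρ : Fin n → Fin m) (bs : List (Label × Ty 0 × Ty n)) →
              map lab (renL ρ bs) ≡ map lab bs
labels-renL ρ []                 = refl
labels-renL ρ ((l , P , T) ∷ bs) = cong (l ∷_) (labels-renL ρ bs)

labels-subL : ∀ {n m} (σ : Fin n → Ty m) (bs : List (Label × Ty 0 × Ty n)) →
              map lab (subL σ bs) ≡ map lab bs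
labels-subL σ []                 = refl
labels-subL σ ((l , P , T) ∷ bs) = cong (l ∷_) (labels-subL σ bs)

wf-ren  : ∀ {n m} (ρ : Fin n → Fin m) {T : Ty n} → WF T → WF (ren ρ T)
wf-renL : ∀ {n m} (ρ : Fin n → Fin m) {bs : List (Label × Ty 0 × Ty n)} →
          AllWF bs → AllWF (renL ρ bs)
wf-ren ρ wf-end = wf-end
wf-ren ρ wf-var = wf-var
wf-ren ρ (wf-mu {T = T} nh w) = wf-mu contractive (wf-ren (ext ρ) w)
  where
  contractive : ¬ HeadVar (ren (ext ρ) T) zero
  contractive h with hv-ren T h
  ... | zero , q , _ = nh q
wf-ren ρ (wf-bra {bs = bs} d a) = wf-bra (subst Unique (sym (labels-renL ρ bs)) d) (wf-renL ρ a)
wf-ren ρ (wf-sel {bs = bs} d a) = wf-sel (subst Unique (sym (labels-renL ρ bs)) d) (wf-renL ρ a)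
wf-renL ρ [] = []
wf-renL ρ ((wp , wt) ∷ a) = (wp , wf-ren ρ wt) ∷ wf-renL ρ a

wf-sub  : ∀ {n m} (σ : Fin n → Ty m) → (∀ x → WF (σ x)) → {T : Ty n} → WF T → WF (sub σ T)
wf-subL : ∀ {n m} (σ : Fin n → Ty m) → (∀ x → WF (σ x)) →
          {bs : List (Label × Ty 0 × Ty n)} → AllWF bs → AllWF (subL σ bs)
wf-sub σ ws wf-end = wf-end
wf-sub σ ws (wf-var {x = x}) = ws x
wf-sub σ ws (wf-mu {T = T} nh w) = wf-mu contractive (wf-sub (exts σ) ws' w)
  where
  ws' : ∀ x → WF (exts σ x)
  ws' zero    = wf-var
  ws' (suc x) = wf-ren suc (ws x)
  contractive : ¬ HeadVar (sub (exts σ) T) zero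
  contractive h with hv-sub T h
  ... | zero , q , _ = nh q
  ... | suc x , _ , r with hv-ren (σ x) r
  ...   | _ , _ , ()
wf-sub σ ws (wf-bra {bs = bs} d a) = wf-bra (subst Unique (sym (labels-subL σ bs)) d) (wf-subL σ ws a)
wf-sub σ ws (wf-sel {bs = bs} d a) = wf-sel (subst Unique (sym (labels-subL σ bs)) d) (wf-subL σ ws a)
wf-subL σ ws [] = []
wf-subL σ ws ((wp , wt) ∷ a) = (wp , wf-sub σ ws wt) ∷ wf-subL σ ws a

wf-unfoldμ : ∀ {T} → WF (μ T) → WF (unfoldμ T)
wf-unfoldμ w@(wf-mu _ wT) = wf-sub _ (λ { zero → w }) wT

wf-unf : ∀ {T H} → Unf T H → WF T → WF H
wf-unf u-end    w = w
wf-unf u-bra    w = w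
wf-unf u-sel    w = w
wf-unf (u-mu u) w = wf-unf u (wf-unfoldμ w)

wf-bra-inv : ∀ {T bs} → WF T → Unf T (bra bs) → Distinct bs × AllWF bs
wf-bra-inv w u with wf-unf u w
... | wf-bra d a = d , a

wf-sel-inv : ∀ {T bs} → WF T → Unf T (sel bs) → Distinct bs × AllWF bs
wf-sel-inv w u with wf-unf u w
... | wf-sel d a = d , a

μ-depth : ∀ {n} → Ty n → ℕ
μ-depth (μ T) = suc (μ-depth T)
μ-depth _     = 0

μ-depth-ren : ∀ {n m} (ρ : Fin n → Fin m) (T : Ty n) → μ-depth (ren ρ T) ≡ μ-depth T
μ-depth-ren ρ end      = refl
μ-depth-ren ρ (var x)  = refl
μ-depth-ren ρ (μ T)    = cong suc (μ-depth-ren (ext ρ) T)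
μ-depth-ren ρ (bra bs) = refl
μ-depth-ren ρ (sel bs) = refl

μ-depth-sub : ∀ {n m} (σ : Fin n → Ty m) (T : Ty n) →
              (∀ x → HeadVar T x → μ-depth (σ x) ≡ 0) → μ-depth (sub σ T) ≡ μ-depth T
μ-depth-sub σ end      h = refl
μ-depth-sub σ (var x)  h = h x hv-var
μ-depth-sub σ (μ T)    h = cong suc (μ-depth-sub (exts σ) T h')
  where
  h' : ∀ x → HeadVar T x → μ-depth (exts σ x) ≡ 0
  h' zero    _  = refl
  h' (suc x) hv = trans (μ-depth-ren suc (σ x)) (h x (hv-mu hv))
μ-depth-sub σ (bra bs) h = refl
μ-depth-sub σ (sel bs) h = refl

-- contractivity: unfolding μt.T strictly decreases the μ-depth
μ-depth-unfoldμ : ∀ {T} → WF (μ T) → μ-depth (unfoldμ T) ≡ μ-depth T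
μ-depth-unfoldμ {T} (wf-mu nh _) = μ-depth-sub _ T (λ { zero h → ⊥-elim (nh h) })

data View (T : Ty 0) : Set where
  v-end : Unf T end → View T
  v-bra : ∀ bs → Unf T (bra bs) → View T
  v-sel : ∀ bs → Unf T (sel bs) → View T

unfolds : ∀ {T} → WF T → View T
unfolds {T} w = go (μ-depth T) T refl w
  where
  go : ∀ k (T : Ty 0) → μ-depth T ≡ k → WF T → View T
  go k end      _ _ = v-end u-end
  go k (bra bs) _ _ = v-bra bs u-bra
  go k (sel bs) _ _ = v-sel bs u-sel
  go (suc k) (μ T) e w with go k (unfoldμ T) (trans (μ-depth-unfoldμ w) (ℕP.suc-injective e)) (wf-unfoldμ w)
  ... | v-end u    = v-end (u-mu u)
  ... | v-bra bs u = v-bra bs (u-mu u)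
  ... | v-sel bs u = v-sel bs (u-mu u)

same-label-same-branch : ∀ {xs : List Br} {x y} → Distinct xs → x ∈ xs → y ∈ xs → lab x ≡ lab y → x ≡ y
same-label-same-branch _ (here refl) (here refl) _ = refl
same-label-same-branch (a ∷ _) (here refl) (there y∈) e = ⊥-elim (All.lookup (AllP.map⁻ a) y∈ e)
same-label-same-branch (a ∷ _) (there x∈) (here refl) e = ⊥-elim (All.lookup (AllP.map⁻ a) x∈ (sym e))
same-label-same-branch (_ ∷ u) (there x∈) (there y∈) e = same-label-same-branch u x∈ y∈ e

match-unique : ∀ {xs l} → Distinct xs → (m m' : Match l xs) → proj₁ m ≡ proj₁ m'
match-unique d (x , x∈ , ex) (y , y∈ , ey) = same-label-same-branch d x∈ y∈ (trans ex (sym ey))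

match? : ∀ l xs → Dec (Match l xs)
match? l xs = map′ find (λ (b , b∈ , e) → lose b∈ e) (any? (λ b → lab b ≟ l) xs)

retarget : ∀ {l xs ys} → xs ≡ ys → Match l xs → Match l ys
retarget e (b , b∈ , eq) = b , subst (b ∈_) e b∈ , eq

bo-ren  : ∀ {n m} (ρ : Fin n → Fin m) {T : Ty n} → BraOut T → BraOut (ren ρ T)
bo-renA : ∀ {n m} (ρ : Fin n → Fin m) {bs : List (Label × Ty 0 × Ty n)} →
          Any (λ b → BraOut (cont b)) bs → Any (λ b → BraOut (cont b)) (renL ρ bs)
bo-ren ρ bo-end     = bo-end
bo-ren ρ bo-var     = bo-var
bo-ren ρ (bo-sel a) = bo-sel (bo-renA ρ a)
bo-ren ρ (bo-mu p)  = bo-mu (bo-ren (ext ρ) p)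
bo-renA ρ (here p)  = here (bo-ren ρ p)
bo-renA ρ (there a) = there (bo-renA ρ a)

bo-sub  : ∀ {n m} (σ : Fin n → Ty m) → (∀ x → BraOut (σ x)) → {T : Ty n} → BraOut T → BraOut (sub σ T)
bo-subA : ∀ {n m} (σ : Fin n → Ty m) → (∀ x → BraOut (σ x)) → {bs : List (Label × Ty 0 × Ty n)} →
          Any (λ b → BraOut (cont b)) bs → Any (λ b → BraOut (cont b)) (subL σ bs)
bo-sub σ h bo-end           = bo-end
bo-sub σ h (bo-var {x = x}) = h x
bo-sub σ h (bo-sel a)       = bo-sel (bo-subA σ h a)
bo-sub σ h (bo-mu p)        = bo-mu (bo-sub (exts σ) h' p)
  where
  h' : ∀ x → BraOut (exts σ x)
  h' zero    = bo-var
  h' (suc x) = bo-ren suc (h x)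
bo-subA σ h (here p)  = here (bo-sub σ h p)
bo-subA σ h (there a) = there (bo-subA σ h a)

-- & ∉ T[σ] implies & ∉ T: the witnessing path of T[σ] either stays in T or
-- ends at a variable of T, and variables satisfy & ∉.
bo-sub⁻  : ∀ {n m} (σ : Fin n → Ty m) (T : Ty n) → BraOut (sub σ T) → BraOut T
bo-subA⁻ : ∀ {n m} (σ : Fin n → Ty m) (bs : List (Label × Ty 0 × Ty n)) →
           Any (λ b → BraOut (cont b)) (subL σ bs) → Any (λ b → BraOut (cont b)) bs
bo-sub⁻ σ end      _          = bo-end
bo-sub⁻ σ (var x)  _          = bo-var
bo-sub⁻ σ (μ T)    (bo-mu p)  = bo-mu (bo-sub⁻ (exts σ) T p)
bo-sub⁻ σ (sel bs) (bo-sel a) = bo-sel (bo-subA⁻ σ bs a)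
bo-subA⁻ σ ((l , P , T) ∷ bs) (here p)  = here (bo-sub⁻ σ T p)
bo-subA⁻ σ ((l , P , T) ∷ bs) (there a) = there (bo-subA⁻ σ bs a)

bo-unf : ∀ {T H} → Unf T H → BraOut T → BraOut H
bo-unf u-end    p         = p
bo-unf u-bra    p         = p
bo-unf u-sel    p         = p
bo-unf (u-mu u) (bo-mu p) = bo-unf u (bo-sub _ (λ { zero → bo-mu p }) p)

bo-unf⁻ : ∀ {T H} → Unf T H → BraOut H → BraOut T
bo-unf⁻ u-end    p = p
bo-unf⁻ u-bra    p = p
bo-unf⁻ u-sel    p = p
bo-unf⁻ (u-mu {T = T} u) p = bo-mu (bo-sub⁻ _ T (bo-unf⁻ u p))

braIn-braOut : ∀ {n} {X : Ty n} → BraIn X → BraOut X → ⊥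
braIn-braOutA : ∀ {n} {bs : List (Label × Ty 0 × Ty n)} →
                All (λ b → BraIn (cont b)) bs → Any (λ b → BraOut (cont b)) bs → ⊥
braIn-braOut (bi-sel a) (bo-sel q) = braIn-braOutA a q
braIn-braOut (bi-mu p)  (bo-mu q)  = braIn-braOut p q
braIn-braOutA (p ∷ _) (here q)  = braIn-braOut p q
braIn-braOutA (_ ∷ a) (there q) = braIn-braOutA a q

¬braOut⇒braIn  : ∀ {n} (X : Ty n) → ¬ BraOut X → BraIn X
¬braOut⇒braInA : ∀ {n} (bs : List (Label × Ty 0 × Ty n)) →
                 ¬ Any (λ b → BraOut (cont b)) bs → All (λ b → BraIn (cont b)) bs
¬braOut⇒braIn end      nb = ⊥-elim (nb bo-end)
¬braOut⇒braIn (var x)  nb = ⊥-elim (nb bo-var)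
¬braOut⇒braIn (μ T)    nb = bi-mu (¬braOut⇒braIn T (λ p → nb (bo-mu p)))
¬braOut⇒braIn (bra bs) nb = bi-bra
¬braOut⇒braIn (sel bs) nb = bi-sel (¬braOut⇒braInA bs (λ a → nb (bo-sel a)))
¬braOut⇒braInA []                 _  = []
¬braOut⇒braInA ((l , P , T) ∷ bs) na =
  ¬braOut⇒braIn T (λ p → na (here p)) ∷ ¬braOut⇒braInA bs (λ a → na (there a))

so-ren  : ∀ {n m} (ρ : Fin n → Fin m) {T : Ty n} → SelOut T → SelOut (ren ρ T)
so-renA : ∀ {n m} (ρ : Fin n → Fin m) {bs : List (Label × Ty 0 × Ty n)} →
          Any (λ b → SelOut (cont b)) bs → Any (λ b → SelOut (cont b)) (renL ρ bs)
so-ren ρ so-end     = so-end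
so-ren ρ so-var     = so-var
so-ren ρ (so-bra a) = so-bra (so-renA ρ a)
so-ren ρ (so-mu p)  = so-mu (so-ren (ext ρ) p)
so-renA ρ (here p)  = here (so-ren ρ p)
so-renA ρ (there a) = there (so-renA ρ a)

so-sub  : ∀ {n m} (σ : Fin n → Ty m) → (∀ x → SelOut (σ x)) → {T : Ty n} → SelOut T → SelOut (sub σ T)
so-subA : ∀ {n m} (σ : Fin n → Ty m) → (∀ x → SelOut (σ x)) → {bs : List (Label × Ty 0 × Ty n)} →
          Any (λ b → SelOut (cont b)) bs → Any (λ b → SelOut (cont b)) (subL σ bs)
so-sub σ h so-end           = so-end
so-sub σ h (so-var {x = x}) = h x
so-sub σ h (so-bra a)       = so-bra (so-subA σ h a)
so-sub σ h (so-mu p)        = so-mu (so-sub (exts σ) h' p)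
  where
  h' : ∀ x → SelOut (exts σ x)
  h' zero    = so-var
  h' (suc x) = so-ren suc (h x)
so-subA σ h (here p)  = here (so-sub σ h p)
so-subA σ h (there a) = there (so-subA σ h a)

so-unf : ∀ {T H} → Unf T H → SelOut T → SelOut H
so-unf u-end    p         = p
so-unf u-bra    p         = p
so-unf u-sel    p         = p
so-unf (u-mu u) (so-mu p) = so-unf u (so-sub _ (λ { zero → so-mu p }) p)

-- SelInN k T: every path from the root of T meets a selection after at
-- most k branching or μ nodes.  The bound survives unfolding, which makes it
-- a termination measure for building a context out of the branching prefix.

data SelInN : ℕ → ∀ {n} → Ty n → Set where
  sn-sel : ∀ {k n} {bs : List (Label × Ty 0 × Ty n)} → SelInN k (sel bs)
  sn-bra : ∀ {k n} {bs : List (Label × Ty 0 × Ty n)} →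
           All (λ b → SelInN k (cont b)) bs → SelInN (suc k) (bra bs)
  sn-mu  : ∀ {k n} {T : Ty (suc n)} → SelInN k T → SelInN (suc k) (μ T)

sn-weaken  : ∀ {k k' n} {X : Ty n} → k ≤ k' → SelInN k X → SelInN k' X
sn-weakenA : ∀ {k k' n} {bs : List (Label × Ty 0 × Ty n)} → k ≤ k' →
             All (λ b → SelInN k (cont b)) bs → All (λ b → SelInN k' (cont b)) bs
sn-weaken le       sn-sel     = sn-sel
sn-weaken (s≤s le) (sn-bra a) = sn-bra (sn-weakenA le a)
sn-weaken (s≤s le) (sn-mu p)  = sn-mu (sn-weaken le p)
sn-weakenA le []      = []
sn-weakenA le (p ∷ a) = sn-weaken le p ∷ sn-weakenA le a

¬selOut⇒selIn  : ∀ {n} (T : Ty n) → ¬ SelOut T → Σ[ k ∈ ℕ ] SelInN k T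
¬selOut⇒selInA : ∀ {n} (bs : List (Label × Ty 0 × Ty n)) →
                 ¬ Any (λ b → SelOut (cont b)) bs → Σ[ k ∈ ℕ ] All (λ b → SelInN k (cont b)) bs
¬selOut⇒selIn end     ns = ⊥-elim (ns so-end)
¬selOut⇒selIn (var x) ns = ⊥-elim (ns so-var)
¬selOut⇒selIn (μ T)   ns with ¬selOut⇒selIn T (λ s → ns (so-mu s))
... | k , p = suc k , sn-mu p
¬selOut⇒selIn (bra bs) ns with ¬selOut⇒selInA bs (λ a → ns (so-bra a))
... | k , a = suc k , sn-bra a
¬selOut⇒selIn (sel bs) ns = 0 , sn-sel
¬selOut⇒selInA [] _ = 0 , []
¬selOut⇒selInA ((l , P , T) ∷ bs) na
  with ¬selOut⇒selIn T (λ s → na (here s)) | ¬selOut⇒selInA bs (λ a → na (there a))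
... | k₁ , p | k₂ , a = k₁ ⊔ k₂ , sn-weaken (ℕP.m≤m⊔n k₁ k₂) p ∷ sn-weakenA (ℕP.m≤n⊔m k₁ k₂) a

sn-sub  : ∀ {k n m} (σ : Fin n → Ty m) {T : Ty n} → SelInN k T → SelInN k (sub σ T)
sn-subA : ∀ {k n m} (σ : Fin n → Ty m) {bs : List (Label × Ty 0 × Ty n)} →
          All (λ b → SelInN k (cont b)) bs → All (λ b → SelInN k (cont b)) (subL σ bs)
sn-sub σ sn-sel     = sn-sel
sn-sub σ (sn-bra a) = sn-bra (sn-subA σ a)
sn-sub σ (sn-mu p)  = sn-mu (sn-sub (exts σ) p)
sn-subA σ []      = []
sn-subA σ (p ∷ a) = sn-sub σ p ∷ sn-subA σ a

sn-unf : ∀ {k T H} → Unf T H → SelInN k T → SelInN k H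
sn-unf u-end    p         = p
sn-unf u-bra    p         = p
sn-unf u-sel    p         = p
sn-unf (u-mu u) (sn-mu p) = sn-unf u (sn-weaken (ℕP.n≤1+n _) (sn-sub _ p))

-- Asynchronous contexts whose holes are selections

IsSel : Ty 0 → Set
IsSel X = Σ[ ss ∈ List Br ] Unf X (sel ss)

record SelCtx (S : Ty 0) : Set where
  constructor selCtx
  field
    ctx     : Ctx S
    selHole : (h : Hole ctx) → IsSel (holeTy h)

  sels : Hole ctx → List Br
  sels h = proj₁ (selHole h)

  unfoldHole : (h : Hole ctx) → Unf (holeTy h) (sel (sels h))
  unfoldHole h = proj₂ (selHole h)

open SelCtx

trivialCtx : ∀ {S ss} → Unf S (sel ss) → SelCtx S
trivialCtx {ss = ss} u = selCtx hole (λ { here → ss , u })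

selCtx-node : ∀ {S ss} → Unf S (bra ss) → (D : SelCtx S) → IsNode (ctx D)
selCtx-node u (selCtx hole sh)       = ⊥-elim (bra≢sel u (proj₂ (sh here)))
selCtx-node u (selCtx (node _ _) sh) = is-node

-- The decomposition of S into a context with selection holes is unique: the
-- context must follow every branching of S and stop at every selection.
ctx-unique  : ∀ {S} (c c' : Ctx S) → ((h : Hole c) → IsSel (holeTy h)) →
              ((h : Hole c') → IsSel (holeTy h)) → c ≡ c'
ctxL-unique : ∀ {bs} (cs cs' : CtxL bs) → ((h : HoleL cs) → IsSel (holeTyL h)) →
              ((h : HoleL cs') → IsSel (holeTyL h)) → cs ≡ cs'
ctx-unique hole hole _ _ = refl
ctx-unique hole (node u cs) sh _ = ⊥-elim (bra≢sel u (proj₂ (sh here)))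
ctx-unique (node u cs) hole _ sh' = ⊥-elim (bra≢sel u (proj₂ (sh' here)))
ctx-unique (node u cs) (node u' cs') sh sh' with bra-unf-inj u u'
... | refl with unf-irrelevant u u'
...   | refl = cong (node u) (ctxL-unique cs cs' (λ h → sh (there h)) (λ h → sh' (there h)))
ctxL-unique [] [] _ _ = refl
ctxL-unique (c ∷ cs) (c' ∷ cs') sh sh' =
  cong₂ _∷_ (ctx-unique c c' (λ h → sh (hd h)) (λ h → sh' (hd h)))
            (ctxL-unique cs cs' (λ h → sh (tl h)) (λ h → sh' (tl h)))

-- A type with ⊕ ∉ S has a path avoiding selections, so it cannot be
-- decomposed into a context with selection holes.
selOut-no-ctx  : ∀ {X} → SelOut X → (c : Ctx X) → ((h : Hole c) → IsSel (holeTy h)) → ⊥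
selOut-no-ctxL : ∀ {bs} → Any (λ b → SelOut (cont b)) bs → (cs : CtxL bs) →
                 ((h : HoleL cs) → IsSel (holeTyL h)) → ⊥
selOut-no-ctx so hole sh with so-unf (proj₂ (sh here)) so
... | ()
selOut-no-ctx so (node u cs) sh with so-unf u so
... | so-bra a = selOut-no-ctxL a cs (λ h → sh (there h))
selOut-no-ctxL (here p)  (c ∷ cs) sh = selOut-no-ctx p c (λ h → sh (hd h))
selOut-no-ctxL (there a) (c ∷ cs) sh = selOut-no-ctxL a cs (λ h → sh (tl h))

selOut-no-selCtx : ∀ {S} → SelOut S → ¬ SelCtx S
selOut-no-selCtx so (selCtx c sh) = selOut-no-ctx so c sh

build  : ∀ k {X} → WF X → SelInN k X → SelCtx X
buildL : ∀ k {bs} → All (λ b → SelInN k (cont b)) bs → AllWF bs →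
         Σ[ cs ∈ CtxL bs ] ((h : HoleL cs) → IsSel (holeTyL h))
build k w p with unfolds w
... | v-end u with sn-unf u p
...   | ()
build k w p | v-sel ss u = trivialCtx u
build zero w p | v-bra bs u with sn-unf u p
... | ()
build (suc k) w p | v-bra bs u with sn-unf u p
... | sn-bra a with buildL k a (proj₂ (wf-bra-inv w u))
...   | cs , sh = selCtx (node u cs) (λ { (there h) → sh h })
buildL k [] [] = [] , λ ()
buildL k (p ∷ ps) ((_ , w) ∷ ws) with build k w p | buildL k ps ws
... | selCtx c sh | cs , shs = c ∷ cs , λ { (hd h) → sh h ; (tl h) → shs h }

selCtx-of : ∀ {S} → WF S → ¬ SelOut S → SelCtx S
selCtx-of {S} w ns = build (proj₁ sn) w (proj₂ sn)
  where
  sn : Σ[ k ∈ ℕ ] SelInN k S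
  sn = ¬selOut⇒selIn S ns

holesWF  : ∀ {S} → WF S → (c : Ctx S) (h : Hole c) → WF (holeTy h)
holesWFL : ∀ {bs} → AllWF bs → (cs : CtxL bs) (h : HoleL cs) → WF (holeTyL h)
holesWF w hole here = w
holesWF w (node u cs) (there h) = holesWFL (proj₂ (wf-bra-inv w u)) cs h
holesWFL ((_ , wt) ∷ _) (c ∷ cs) (hd h) = holesWF wt c h
holesWFL (_ ∷ a)        (c ∷ cs) (tl h) = holesWFL a cs h

hole-branches : ∀ {S} → WF S → (D : SelCtx S) (h : Hole (ctx D)) → Distinct (sels D h) × AllWF (sels D h)
hole-branches w D h = wf-sel-inv (holesWF w (ctx D) h) (unfoldHole D h)

labels-fillL : ∀ {bs} (cs : CtxL bs) f → map lab (fillL cs f) ≡ map lab bs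
labels-fillL []              f = refl
labels-fillL (_∷_ {l} c cs) f = cong (l ∷_) (labels-fillL cs _)

wf-fill  : ∀ {S} → WF S → (c : Ctx S) (f : Hole c → Ty 0) → (∀ h → WF (f h)) → WF (fill c f)
wf-fillL : ∀ {bs} → AllWF bs → (cs : CtxL bs) (f : HoleL cs → Ty 0) → (∀ h → WF (f h)) →
           AllWF (fillL cs f)
wf-fill w hole f wf = wf here
wf-fill w (node u cs) f wf with wf-unf u w
... | wf-bra d a = wf-bra (subst Unique (sym (labels-fillL cs _)) d) (wf-fillL a cs _ (λ h → wf (there h)))
wf-fillL [] [] f wf = []
wf-fillL ((wp , wt) ∷ a) (c ∷ cs) f wf =
  (wp , wf-fill wt c _ (λ h → wf (hd h))) ∷ wf-fillL a cs _ (λ h → wf (tl h))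

fill-cong  : ∀ {S} (c : Ctx S) {f g : Hole c → Ty 0} → (∀ h → f h ≡ g h) → fill c f ≡ fill c g
fillL-cong : ∀ {bs} (cs : CtxL bs) {f g : HoleL cs → Ty 0} → (∀ h → f h ≡ g h) → fillL cs f ≡ fillL cs g
fill-cong hole        eq = eq here
fill-cong (node u cs) eq = cong bra (fillL-cong cs (λ h → eq (there h)))
fillL-cong []                   eq = refl
fillL-cong (_∷_ {l} {P} c cs) eq =
  cong₂ (λ X Y → (l , P , X) ∷ Y) (fill-cong c (λ h → eq (hd h))) (fillL-cong cs (λ h → eq (tl h)))

-- One step of ≤a, and its inversion principles

IsAsyncSim : Rel → Set
IsAsyncSim R = ∀ {T S} → R T S → WF T × WF S × SubF R T S

BraSim : Rel → List Br → List Br → Set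
BraSim R ts ss = ∀ {b'} → b' ∈ ss →
  Σ[ b ∈ Br ] (b ∈ ts × lab b ≡ lab b' × R (pay b) (pay b') × R (cont b) (cont b'))

SimAlong : Rel → ∀ {S} → SelCtx S → List Br → Set
SimAlong R D ts = ∀ {b} → b ∈ ts →
  Σ[ g ∈ ((h : Hole (ctx D)) → Match (lab b) (sels D h)) ]
    ((∀ h → R (pay (proj₁ (g h))) (pay b)) × R (cont b) (fill (ctx D) (λ h → cont (proj₁ (g h)))))

CtxSim : Rel → Ty 0 → List Br → Set
CtxSim R S ts = Σ[ D ∈ SelCtx S ] SimAlong R D ts

module _ {R : Rel} where

  step-end : ∀ {T S} → SubF R T S → Unf T end → Unf S end
  step-end (inj₁ (_ , uS))                              uT = uS
  step-end (inj₂ (inj₁ (_ , _ , uT' , _)))              uT = ⊥-elim (end≢bra uT uT')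
  step-end (inj₂ (inj₂ (inj₁ (_ , _ , uT' , _))))       uT = ⊥-elim (end≢sel uT uT')
  step-end (inj₂ (inj₂ (inj₂ (_ , uT' , _))))           uT = ⊥-elim (end≢sel uT uT')

  step-end⁻ : ∀ {T S} → SubF R T S → Unf S end → Unf T end
  step-end⁻ (inj₁ (uT , _))                                        uS = uT
  step-end⁻ (inj₂ (inj₁ (_ , _ , _ , uS' , _)))                    uS = ⊥-elim (end≢bra uS uS')
  step-end⁻ (inj₂ (inj₂ (inj₁ (_ , _ , _ , uS' , _))))             uS = ⊥-elim (end≢sel uS uS')
  step-end⁻ (inj₂ (inj₂ (inj₂ (_ , _ , node u _ , is-node , _)))) uS = ⊥-elim (end≢bra uS u)

  step-bra : ∀ {T S ts ss} → SubF R T S → Unf T (bra ts) → Unf S (bra ss) → BraSim R ts ss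
  step-bra (inj₁ (uT' , _)) uT uS = ⊥-elim (end≢bra uT' uT)
  step-bra (inj₂ (inj₁ (_ , _ , uT' , uS' , F))) uT uS
    with bra-unf-inj uT uT' | bra-unf-inj uS uS'
  ... | refl | refl = F
  step-bra (inj₂ (inj₂ (inj₁ (_ , _ , uT' , _)))) uT uS = ⊥-elim (bra≢sel uT uT')
  step-bra (inj₂ (inj₂ (inj₂ (_ , uT' , _))))     uT uS = ⊥-elim (bra≢sel uT uT')

  step-bra-sel : ∀ {T S ts ss} → SubF R T S → Unf T (bra ts) → ¬ Unf S (sel ss)
  step-bra-sel (inj₁ (uT' , _))                        uT uS = end≢bra uT' uT
  step-bra-sel (inj₂ (inj₁ (_ , _ , _ , uS' , _)))     uT uS = bra≢sel uS' uS
  step-bra-sel (inj₂ (inj₂ (inj₁ (_ , _ , uT' , _))))  uT uS = bra≢sel uT uT'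
  step-bra-sel (inj₂ (inj₂ (inj₂ (_ , uT' , _))))      uT uS = bra≢sel uT uT'

  step-sel : ∀ {T S ts} → SubF R T S → Unf T (sel ts) → CtxSim R S ts
  step-sel (inj₁ (uT' , _))                       uT = ⊥-elim (end≢sel uT' uT)
  step-sel (inj₂ (inj₁ (_ , _ , uT' , _)))        uT = ⊥-elim (bra≢sel uT' uT)
  step-sel (inj₂ (inj₂ (inj₁ (_ , _ , uT' , uS' , F)))) uT with sel-unf-inj uT uT'
  ... | refl = trivialCtx uS' , along
    where
    along : SimAlong R (trivialCtx uS') _
    along b∈ with F b∈
    ... | b' , b'∈ , e , p , q = (λ { here → b' , b'∈ , e }) , (λ { here → p }) , q
  step-sel (inj₂ (inj₂ (inj₂ (_ , uT' , c , _ , sl , us , F)))) uT with sel-unf-inj uT uT'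
  ... | refl = selCtx c (λ h → sl h , us h) , along
    where
    along : SimAlong R (selCtx c (λ h → sl h , us h)) _
    along b∈ with F b∈
    ... | g , p , q , _ = g , p , q

  -- if S is a branching then & ∈ T: either T is a branching, or its
  -- continuations after anticipated outputs all have & ∈
  step-braOut : ∀ {T S ss} → SubF R T S → Unf S (bra ss) → ¬ BraOut T
  step-braOut (inj₁ (_ , uS')) uS bo = end≢bra uS' uS
  step-braOut (inj₂ (inj₁ (_ , _ , uT , _))) uS bo with bo-unf uT bo
  ... | ()
  step-braOut (inj₂ (inj₂ (inj₁ (_ , _ , _ , uS' , _)))) uS bo = bra≢sel uS uS'
  step-braOut (inj₂ (inj₂ (inj₂ (_ , uT , _ , _ , _ , _ , F)))) uS bo with bo-unf uT bo
  ... | bo-sel a with find a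
  ...   | b , b∈ , p = braIn-braOut (proj₂ (proj₂ (proj₂ (F b∈)))) p

  -- A simulation along one decomposition transfers to any other: by
  -- uniqueness they share the context, and the selections at each hole agree.
  align : ∀ {S ts} (D : SelCtx S) → CtxSim R S ts → SimAlong R D ts
  align (selCtx c sh) (selCtx c' sh' , G) with ctx-unique c c' sh sh'
  ... | refl = along
    where
    along : SimAlong R (selCtx c sh) _
    along b∈ with G b∈
    ... | g , p , q = (λ h → retarget (sel-unf-inj (proj₂ (sh' h)) (proj₂ (sh h))) (g h)) , p , q

  along-match : ∀ {S ts b} (D : SelCtx S) → CtxSim R S ts → b ∈ ts → (h : Hole (ctx D)) →
                Match (lab b) (sels D h)
  along-match D sim b∈ = proj₁ (align D sim b∈)

  along-pay : ∀ {S ts b} → WF S → (D : SelCtx S) → CtxSim R S ts → b ∈ ts →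
              (h : Hole (ctx D)) (m : Match (lab b) (sels D h)) → R (pay (proj₁ m)) (pay b)
  along-pay wS D sim b∈ h m with align D sim b∈
  ... | g , p , _ rewrite match-unique (proj₁ (hole-branches wS D h)) m (g h) = p h

  along-cont : ∀ {S ts b} → WF S → (D : SelCtx S) → CtxSim R S ts → (b∈ : b ∈ ts) →
               (g : (h : Hole (ctx D)) → Match (lab b) (sels D h)) →
               R (cont b) (fill (ctx D) (λ h → cont (proj₁ (g h))))
  along-cont {b = b} wS D sim b∈ g with align D sim b∈
  ... | g' , _ , q = subst (R (cont b)) (fill-cong (ctx D) same-cont) q
    where
    same-cont : ∀ h → cont (proj₁ (g' h)) ≡ cont (proj₁ (g h))
    same-cont h = cong cont (match-unique (proj₁ (hole-branches wS D h)) (g' h) (g h))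

-- Soundness: a derivation of T ⋪a S refutes every simulation relating T, S

module _ {R : Rel} (sim : IsAsyncSim R) where

  private
    wfL : ∀ {T S} → R T S → WF T
    wfL r = proj₁ (sim r)

    wfR : ∀ {T S} → R T S → WF S
    wfR r = proj₁ (proj₂ (sim r))

    step : ∀ {T S} → R T S → SubF R T S
    step r = proj₂ (proj₂ (sim r))

  bra-related : ∀ {T S ts ss b b'} → R T S → Unf T (bra ts) → Unf S (bra ss) →
                b ∈ ts → b' ∈ ss → lab b ≡ lab b' → R (pay b) (pay b') × R (cont b) (cont b')
  bra-related r uT uS b∈ b'∈ e with step-bra (step r) uT uS b'∈
  ... | b₁ , b₁∈ , e₁ , p , q
    with same-label-same-branch (proj₁ (wf-bra-inv (wfL r) uT)) b∈ b₁∈ (trans e (sym e₁))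
  ...   | refl = p , q

  refute : ∀ {T S} → T ⋪a S → ¬ R T S
  refute (n-endL uT nS) r = nS (step-end (step r) uT)
  refute (n-endR nT uS) r = nT (step-end⁻ (step r) uS)
  refute (n-bra-sel uT uS) r = step-bra-sel (step r) uT uS
  refute (n-bra-a uT uS b'∈ f) r with step-bra (step r) uT uS b'∈
  ... | _ , b∈ , e , _ = f b∈ e
  refute (n-bra-b uT uS b∈ b'∈ e d) r = refute d (proj₁ (bra-related r uT uS b∈ b'∈ e))
  refute (n-bra-c uT uS b∈ b'∈ e d) r = refute d (proj₂ (bra-related r uT uS b∈ b'∈ e))
  refute (n-sel-a uT uS b∈ f) r with along-match {R = R} (trivialCtx uS) (step-sel (step r) uT) b∈ here
  ... | _ , b'∈ , e = f b'∈ (sym e)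
  refute (n-sel-b uT uS b∈ b'∈ e d) r =
    refute d (along-pay {R = R} (wfR r) (trivialCtx uS) (step-sel (step r) uT) b∈ here (_ , b'∈ , sym e))
  refute (n-sel-c uT uS b∈ b'∈ e d) r =
    refute d (along-cont {R = R} (wfR r) (trivialCtx uS) (step-sel (step r) uT) b∈ (λ { here → _ , b'∈ , sym e }))
  refute (n-ctx-a uT c sl us b∈ h₀ f) r
    with along-match {R = R} (selCtx c (λ h → sl h , us h)) (step-sel (step r) uT) b∈ h₀
  ... | _ , b'∈ , e = f b'∈ e
  refute (n-ctx-b uT c sl us b∈ h₀ b'∈ e d) r =
    refute d (along-pay {R = R} (wfR r) (selCtx c (λ h → sl h , us h)) (step-sel (step r) uT) b∈ h₀ (_ , b'∈ , e))
  refute (n-ctx-c uT c sl us M b∈ d) r =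
    refute d (along-cont {R = R} (wfR r) (selCtx c (λ h → sl h , us h)) (step-sel (step r) uT) b∈ (M b∈))
  refute (n-notBra uS bo) r = step-braOut (step r) uS bo
  refute (n-notSel uT so) r = selOut-no-selCtx so (proj₁ (step-sel (step r) uT))

-- Completeness: "well-formed and not refuted" is an asynchronous simulation

NotRefuted : Rel
NotRefuted T S = WF T × WF S × ¬ (T ⋪a S)

bra-step : ∀ {T S ts ss} → NotRefuted T S → Unf T (bra ts) → Unf S (bra ss) → BraSim NotRefuted ts ss
bra-step {ts = ts} (wT , wS , nd) uT uS {b'} b'∈ with match? (lab b') ts
... | no none = ⊥-elim (nd (n-bra-a uT uS b'∈ (λ b∈ e → none (_ , b∈ , e))))
... | yes (b , b∈ , e) =
  b , b∈ , e , (proj₁ wb , proj₁ wb' , λ d → nd (n-bra-b uT uS b∈ b'∈ e d))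
             , (proj₂ wb , proj₂ wb' , λ d → nd (n-bra-c uT uS b∈ b'∈ e d))
  where
  wb : WF (pay b) × WF (cont b)
  wb  = All.lookup (proj₂ (wf-bra-inv wT uT)) b∈
  wb' : WF (pay b') × WF (cont b')
  wb' = All.lookup (proj₂ (wf-bra-inv wS uS)) b'∈

sel-step : ∀ {T S ts ss} → NotRefuted T S → Unf T (sel ts) → Unf S (sel ss) →
           ∀ {b} → b ∈ ts → Σ[ b' ∈ Br ] (b' ∈ ss × lab b' ≡ lab b ×
             NotRefuted (pay b') (pay b) × NotRefuted (cont b) (cont b'))
sel-step {ss = ss} (wT , wS , nd) uT uS {b} b∈ with match? (lab b) ss
... | no none = ⊥-elim (nd (n-sel-a uT uS b∈ (λ b'∈ e → none (_ , b'∈ , sym e))))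
... | yes (b' , b'∈ , e) =
  b' , b'∈ , e , (proj₁ wb' , proj₁ wb , λ d → nd (n-sel-b uT uS b∈ b'∈ (sym e) d))
               , (proj₂ wb , proj₂ wb' , λ d → nd (n-sel-c uT uS b∈ b'∈ (sym e) d))
  where
  wb : WF (pay b) × WF (cont b)
  wb  = All.lookup (proj₂ (wf-sel-inv wT uT)) b∈
  wb' : WF (pay b') × WF (cont b')
  wb' = All.lookup (proj₂ (wf-sel-inv wS uS)) b'∈

-- a selection T against a branching S: anticipate T's outputs over the
-- decomposition of S, which exists because ⊕ ∉ S would refute T, S
ctx-step : ∀ {T S ts ss} → NotRefuted T S → Unf T (sel ts) → Unf S (bra ss) → SubF NotRefuted T S
ctx-step {S = S} {ts = ts} (wT , wS , nd) uT uS =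
  inj₂ (inj₂ (inj₂ (ts , uT , ctx D , selCtx-node uS D , sels D , unfoldHole D , related)))
  where
  D : SelCtx S
  D = selCtx-of wS (λ so → nd (n-notSel uT so))

  match : ∀ {b} → b ∈ ts → (h : Hole (ctx D)) → Match (lab b) (sels D h)
  match {b} b∈ h with match? (lab b) (sels D h)
  ... | yes m   = m
  ... | no none = ⊥-elim (nd (n-ctx-a uT (ctx D) (sels D) (unfoldHole D) b∈ h (λ b'∈ e → none (_ , b'∈ , e))))

  matchWF : ∀ {b} (b∈ : b ∈ ts) (h : Hole (ctx D)) → WF (pay (proj₁ (match b∈ h))) × WF (cont (proj₁ (match b∈ h)))
  matchWF b∈ h = All.lookup (proj₂ (hole-branches wS D h)) (proj₁ (proj₂ (match b∈ h)))

  related : ∀ {b} → b ∈ ts →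
    Σ[ g ∈ ((h : Hole (ctx D)) → Match (lab b) (sels D h)) ]
      ((∀ h → NotRefuted (pay (proj₁ (g h))) (pay b)) ×
       NotRefuted (cont b) (fill (ctx D) (λ h → cont (proj₁ (g h)))) × BraIn (cont b))
  related {b} b∈ =
    match b∈ ,
    (λ h → proj₁ (matchWF b∈ h) , proj₁ wb ,
           λ d → nd (n-ctx-b uT (ctx D) (sels D) (unfoldHole D) b∈ h
                       (proj₁ (proj₂ (match b∈ h))) (proj₂ (proj₂ (match b∈ h))) d)) ,
    (proj₂ wb , wf-fill wS (ctx D) _ (λ h → proj₂ (matchWF b∈ h)) ,
     λ d → nd (n-ctx-c uT (ctx D) (sels D) (unfoldHole D) match b∈ d)) ,
    ¬braOut⇒braIn _ (λ bo → nd (n-notBra uS (bo-unf⁻ uT (bo-sel (lose b∈ bo)))))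
    where
    wb : WF (pay b) × WF (cont b)
    wb = All.lookup (proj₂ (wf-sel-inv wT uT)) b∈

complete : ∀ {T S} → NotRefuted T S → SubF NotRefuted T S
complete nr@(wT , wS , nd) with unfolds wT | unfolds wS
... | v-end uT    | v-end uS    = inj₁ (uT , uS)
... | v-end uT    | v-bra _ uS  = ⊥-elim (nd (n-endL uT (λ u → end≢bra u uS)))
... | v-end uT    | v-sel _ uS  = ⊥-elim (nd (n-endL uT (λ u → end≢sel u uS)))
... | v-bra _ uT  | v-end uS    = ⊥-elim (nd (n-endR (λ u → end≢bra u uT) uS))
... | v-sel _ uT  | v-end uS    = ⊥-elim (nd (n-endR (λ u → end≢sel u uT) uS))
... | v-bra _ uT  | v-sel _ uS  = ⊥-elim (nd (n-bra-sel uT uS))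
... | v-bra ts uT | v-bra ss uS = inj₂ (inj₁ (ts , ss , uT , uS , bra-step nr uT uS))
... | v-sel ts uT | v-sel ss uS = inj₂ (inj₂ (inj₁ (ts , ss , uT , uS , sel-step nr uT uS)))
... | v-sel _ uT  | v-bra _ uS  = ctx-step nr uT uS

notRefuted-sim : IsAsyncSim NotRefuted
notRefuted-sim nr@(wT , wS , _) = wT , wS , complete nr

lemma5p3 : ExcludedMiddle 0ℓ → (T S : Ty 0) → WF T → WF S →
             (¬ (T ≤a S)) ⇔ (T ⋪a S)
lemma5p3 em T S wT wS = mk⇔ refuted sound
  where
  -- classical step: if no refutation existed, NotRefuted would witness T ≤a S
  refuted : ¬ (T ≤a S) → T ⋪a S
  refuted T≰S = decidable-stable em (λ nd → T≰S (NotRefuted , (wT , wS , nd) , notRefuted-sim))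

  sound : T ⋪a S → ¬ (T ≤a S)
  sound d (R , r , sim) = refute sim d r
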